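{- Let $L$ be a diamond with least element $0$ and greatest element $1$, and let $G$ be a finite $MH$-homogeneous vertex-uniform $L$-colored graph such that there exist $x_0,y_0\in V(G)$ with $\chi(x_0,y_0)=1$. Then: (1) for every vertex $x$ there is a vertex $y$ with $\chi(x,y)=1$; (2) if $x,y,z$ are distinct vertices with $\chi(x,y)=\chi(y,z)=1$, then $\chi(x,z)=1$; (3) if $x\ne y$ belong to the same connected component of $G$, then $\chi(x,y)=1$.
   Context: A diamond is a poset consisting of a set of pairwise incomparable elements together with a least element $0$ and a greatest element $1$. For a poset $L$ with order $\preceq$, least element $0$ and greatest element $1$: an $L$-colored graph is a triple $G=(V,\chi',\chi'')$ where $V$ is nonempty, $\chi':V\to L$ is arbitrary and $\chi'':V^2\to L$ satisfies $\chi''(x,x)=0$ and $\chi''(x,y)=\chi''(y,x)$. Write $\chi(x)=\chi'(x)$, $\chi(x,y)=\chi''(x,y)$, $V(G)=V$, and $G[W]=(W,\chi'|_W,\chi''|_{W^2})$ for $W\subseteq V$. A homomorphism between $L$-colored graphs is a map $f$ of vertex sets with $\chi_1(x)\preceq\chi_2(f(x))$ and $\chi_1(x,y)\preceq\chi_2(f(x),f(y))$ for all $x,y$; monomorphism = injective homomorphism; endomorphism = homomorphism $G\to G$. $G$ is $MH$-homogeneous if every monomorphism from $G[S]$ to $G[T]$, for finite $S,T\subseteq V$, extends to an endomorphism of $G$. $G$ is vertex-uniform if all vertices have the same color. Connected components of $G$ are the equivalence classes of the reflexive transitive closure of $\{(x,y):\chi(x,y)\ne0\}$. -}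

module Defs where

open import Level using (Level; _⊔_; suc)
open import Data.Nat using (ℕ)
open import Data.Fin using (Fin)
open import Data.Fin.Subset using (Subset; _∈_)
open import Data.Product using (Σ; _×_; proj₁)
open import Relation.Binary.PropositionalEquality using (_≡_; _≢_)
open import Relation.Binary.Structures using (IsPartialOrder)
open import Relation.Binary.Construct.Closure.ReflexiveTransitive using (Star)

record BoundedPoset (c ℓ : Level) : Set (Level.suc (c ⊔ ℓ)) where
  field
    Carrier        : Set c
    _≼_            : Carrier → Carrier → Set ℓ
    isPartialOrder : IsPartialOrder _≡_ _≼_
    𝟘 𝟙            : Carrier
    𝟘-least        : ∀ a → 𝟘 ≼ a
    𝟙-greatest     : ∀ a → a ≼ 𝟙

IsDiamond : ∀ {c ℓ} → BoundedPoset c ℓ → Set (c ⊔ ℓ)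
IsDiamond L = (𝟘 ≢ 𝟙) ×
  (∀ a b → a ≢ 𝟘 → a ≢ 𝟙 → b ≢ 𝟘 → b ≢ 𝟙 → a ≼ b → a ≡ b)
  where open BoundedPoset L

record ColoredGraph {c ℓ} (L : BoundedPoset c ℓ) (n : ℕ) : Set c where
  open BoundedPoset L
  field
    χ′     : Fin n → Carrier
    χ″     : Fin n → Fin n → Carrier
    χ″-diag : ∀ x → χ″ x x ≡ 𝟘
    χ″-sym  : ∀ x y → χ″ x y ≡ χ″ y x

module _ {c ℓ} {L : BoundedPoset c ℓ} {n : ℕ} (G : ColoredGraph L n) where
  open BoundedPoset L
  open ColoredGraph G

  Elem : Subset n → Set
  Elem S = Σ (Fin n) (λ x → x ∈ S)

  IsMono : (S T : Subset n) → (Elem S → Elem T) → Set ℓ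
  IsMono S T f =
    (∀ u v → proj₁ (f u) ≡ proj₁ (f v) → proj₁ u ≡ proj₁ v) ×
    (∀ u → χ′ (proj₁ u) ≼ χ′ (proj₁ (f u))) ×
    (∀ u v → χ″ (proj₁ u) (proj₁ v) ≼ χ″ (proj₁ (f u)) (proj₁ (f v)))

  IsEndo : (Fin n → Fin n) → Set ℓ
  IsEndo g = (∀ x → χ′ x ≼ χ′ (g x)) × (∀ x y → χ″ x y ≼ χ″ (g x) (g y))

  MH-homogeneous : Set ℓ
  MH-homogeneous = ∀ (S T : Subset n) (f : Elem S → Elem T) → IsMono S T f →
    Σ (Fin n → Fin n) λ g → IsEndo g × (∀ u → g (proj₁ u) ≡ proj₁ (f u))

  VertexUniform : Set c
  VertexUniform = ∀ x y → χ′ x ≡ χ′ y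

  Adj : Fin n → Fin n → Set c
  Adj x y = χ″ x y ≢ 𝟘

  SameComponent : Fin n → Fin n → Set c
  SameComponent = Star Adj

-- An endomorphism never lowers colours, so it maps 1-edges to 1-edges. By
-- MH-homogeneity every vertex is the image of x₀ under an endomorphism, which gives (1).
-- For a 1-clique C ∋ y and z ∉ C, the map fixing C ∖ {y} and sending z to y is a
-- monomorphism; extending it to an endomorphism g, the vertex g y is joined by 1 to
-- C ∖ {y} and χ(y,z) ≼ χ(g y, y). Whenever this forces χ(g y, y) = 1, C ∪ {g y} is a
-- strictly larger 1-clique, so by finiteness some such clique eventually contains z.
-- In (2), χ(y,z) = 1 forces it outright. In (3), for an edge y z and a 1-neighbour t
-- of y, χ(y,z) ≠ 0 makes g y ≠ y, and (2) applied to g y, t, y forces it.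
module Submission where

open import Defs
open import Data.Nat using (ℕ; zero; suc; _+_; _<_; _≤_)
open import Data.Nat.Properties using (<⇒≱; ≤-trans; ≤-reflexive; +-suc; +-monoʳ-≤; m≤m+n)
open import Data.Fin using (Fin)
open import Data.Fin.Properties using (_≟_)
open import Data.Fin.Subset using (Subset; _∈_; _∉_; _∪_; _─_; _-_; ⁅_⁆; ∣_∣; ⊤; outside)
open import Data.Fin.Subset.Properties
  using (_∈?_; ∈⊤; x∈⁅x⁆; x∈⁅y⁆⇒x≡y; x∈p∪q⁺; x∈p∪q⁻; p⊆p∪q; p─q⊆p; x∈p∧x≢y⇒x∈p-y;
         p⊂q⇒∣p∣<∣q∣; ∣p∣≤n)
open import Data.Vec using (_∷_; here; there)
open import Data.Product using (Σ; _×_; ∃; _,_; proj₂)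
open import Data.Sum using (_⊎_; inj₁; inj₂)
open import Data.Empty using (⊥-elim)
open import Relation.Nullary using (yes; no)
open import Relation.Binary.PropositionalEquality
  using (_≡_; _≢_; refl; sym; trans; cong; cong₂; subst; ≢-sym)
open import Relation.Binary.Structures using (IsPartialOrder)
open import Relation.Binary.Construct.Closure.ReflexiveTransitive using (fold)

x∈p─q⇒x∉q : ∀ {n} (p q : Subset n) {x : Fin n} → x ∈ p ─ q → x ∉ q
x∈p─q⇒x∉q (_ ∷ p) (outside ∷ q) here ()
x∈p─q⇒x∉q (_ ∷ p) (_ ∷ q) (there x∈p─q) (there x∈q) = x∈p─q⇒x∉q p q x∈p─q x∈q

x∈p-y⇒x≢y : ∀ {n} {p : Subset n} {x y : Fin n} → x ∈ p - y → x ≢ y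
x∈p-y⇒x≢y {p = p} {y = y} x∈p-y refl = x∈p─q⇒x∉q p ⁅ y ⁆ x∈p-y (x∈⁅x⁆ y)

∣p∣<∣p∪⁅x⁆∣ : ∀ {n} {p : Subset n} {x : Fin n} → x ∉ p → ∣ p ∣ < ∣ p ∪ ⁅ x ⁆ ∣
∣p∣<∣p∪⁅x⁆∣ {x = x} x∉p = p⊂q⇒∣p∣<∣q∣ (p⊆p∪q ⁅ x ⁆ , x , x∈p∪q⁺ (inj₂ (x∈⁅x⁆ x)) , x∉p)

grow-until-∈ : ∀ {n a} (Q : Subset n → Set a) {z : Fin n} →
  (∀ {C} → Q C → z ∉ C → ∃ λ w → w ∉ C × Q (C ∪ ⁅ w ⁆)) →
  ∀ {C} → Q C → ∃ λ C → Q C × z ∈ C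
grow-until-∈ {n} Q {z} step {C₀} q₀ = go n q₀ (m≤m+n n ∣ C₀ ∣)
  where
  -- fuel: at most k more vertices fit into C
  go : ∀ k {C} → Q C → n ≤ k + ∣ C ∣ → ∃ λ C → Q C × z ∈ C
  go k {C} q bound with z ∈? C
  ... | yes z∈C = C , q , z∈C
  ... | no z∉C with step q z∉C
  ... | w , w∉C , q′ with k
  ... | zero = ⊥-elim (<⇒≱ (∣p∣<∣p∪⁅x⁆∣ w∉C) (≤-trans (∣p∣≤n (C ∪ ⁅ w ⁆)) bound))
  ... | suc k′ = go k′ q′ (≤-trans bound
          (≤-trans (≤-reflexive (sym (+-suc k′ ∣ C ∣))) (+-monoʳ-≤ k′ (∣p∣<∣p∪⁅x⁆∣ w∉C))))

module Colouring {c ℓ} {L : BoundedPoset c ℓ} {n : ℕ} (G : ColoredGraph L n) where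
  open BoundedPoset L
  open ColoredGraph G
  open IsPartialOrder isPartialOrder using (reflexive; antisym)

  𝟙-maximal : ∀ {a} → 𝟙 ≼ a → a ≡ 𝟙
  𝟙-maximal = antisym (𝟙-greatest _)

  𝟘-minimal : ∀ {a} → a ≼ 𝟘 → a ≡ 𝟘
  𝟘-minimal a≼𝟘 = antisym a≼𝟘 (𝟘-least _)

  χ″-diag-≼ : ∀ a s → χ″ a a ≼ s
  χ″-diag-≼ a s = subst (_≼ s) (sym (χ″-diag a)) (𝟘-least s)

  χ″-𝟙-≼ : ∀ {a b} → χ″ a b ≡ 𝟙 → ∀ s → s ≼ χ″ a b
  χ″-𝟙-≼ eq s = subst (s ≼_) (sym eq) (𝟙-greatest s)

  endo-preserves-𝟙 : ∀ {g a b} → IsEndo G g → χ″ a b ≡ 𝟙 → χ″ (g a) (g b) ≡ 𝟙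
  endo-preserves-𝟙 {a = a} {b} (_ , ≼χ″) eq = 𝟙-maximal (subst (_≼ _) eq (≼χ″ a b))

  Is𝟙Clique : Subset n → Set c
  Is𝟙Clique C = ∀ {a b} → a ∈ C → b ∈ C → a ≢ b → χ″ a b ≡ 𝟙

  ⁅⁆-clique : ∀ a → Is𝟙Clique ⁅ a ⁆
  ⁅⁆-clique a x∈ y∈ x≢y = ⊥-elim (x≢y (trans (x∈⁅y⁆⇒x≡y a x∈) (sym (x∈⁅y⁆⇒x≡y a y∈))))

  clique-∪⁅⁆ : ∀ {C w} → Is𝟙Clique C → (∀ {b} → b ∈ C → χ″ w b ≡ 𝟙) → Is𝟙Clique (C ∪ ⁅ w ⁆)
  clique-∪⁅⁆ {C} {w} cl w𝟙 x∈ y∈ x≢y with x∈p∪q⁻ C ⁅ w ⁆ x∈ | x∈p∪q⁻ C ⁅ w ⁆ y∈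
  ... | inj₁ x∈C | inj₁ y∈C = cl x∈C y∈C x≢y
  ... | inj₂ x∈w | inj₁ y∈C rewrite x∈⁅y⁆⇒x≡y w x∈w = w𝟙 y∈C
  ... | inj₁ x∈C | inj₂ y∈w rewrite x∈⁅y⁆⇒x≡y w y∈w = trans (χ″-sym _ w) (w𝟙 x∈C)
  ... | inj₂ x∈w | inj₂ y∈w = ⊥-elim (x≢y (trans (x∈⁅y⁆⇒x≡y w x∈w) (sym (x∈⁅y⁆⇒x≡y w y∈w))))

  edge-clique : ∀ {a b} → χ″ a b ≡ 𝟙 → Is𝟙Clique (⁅ a ⁆ ∪ ⁅ b ⁆)
  edge-clique {a} {b} eq = clique-∪⁅⁆ (⁅⁆-clique a) b𝟙
    where
    b𝟙 : ∀ {x} → x ∈ ⁅ a ⁆ → χ″ b x ≡ 𝟙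
    b𝟙 x∈ rewrite x∈⁅y⁆⇒x≡y a x∈ = trans (χ″-sym b a) eq

  module Homogeneous (mh : MH-homogeneous G) (vu : VertexUniform G) where

    extend-to-endo : ∀ S (f : Fin n → Fin n) →
      (∀ {a b} → a ∈ S → b ∈ S → f a ≡ f b → a ≡ b) →
      (∀ {a b} → a ∈ S → b ∈ S → χ″ a b ≼ χ″ (f a) (f b)) →
      ∃ λ g → IsEndo G g × (∀ {a} → a ∈ S → g a ≡ f a)
    extend-to-endo S f inj ≼f =
      let g , endo , agree = mh S ⊤ (λ (a , _) → f a , ∈⊤) mono
      in g , endo , λ a∈S → agree (_ , a∈S)
      where
      mono : IsMono G S ⊤ (λ (a , _) → f a , ∈⊤)
      mono = (λ (_ , a∈) (_ , b∈) → inj a∈ b∈)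
           , (λ _ → reflexive (vu _ _))
           , (λ (_ , a∈) (_ , b∈) → ≼f a∈ b∈)

    endo-sending : ∀ a b → ∃ λ g → IsEndo G g × g a ≡ b
    endo-sending a b =
      let g , endo , agree = extend-to-endo ⁅ a ⁆ (λ _ → b) (λ x∈ y∈ _ → same x∈ y∈) same-≼
      in g , endo , agree (x∈⁅x⁆ a)
      where
      same : ∀ {x y} → x ∈ ⁅ a ⁆ → y ∈ ⁅ a ⁆ → x ≡ y
      same x∈ y∈ = trans (x∈⁅y⁆⇒x≡y a x∈) (sym (x∈⁅y⁆⇒x≡y a y∈))

      same-≼ : ∀ {x y} → x ∈ ⁅ a ⁆ → y ∈ ⁅ a ⁆ → χ″ x y ≼ χ″ b b
      same-≼ x∈ y∈ rewrite same x∈ y∈ = χ″-diag-≼ _ _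

    redirect-endo : ∀ {C y z} → Is𝟙Clique C → y ∈ C → z ∉ C →
      ∃ λ g → IsEndo G g × (∀ {c} → c ∈ C → c ≢ y → g c ≡ c) × g z ≡ y
    redirect-endo {C} {y} {z} cl y∈C z∉C =
      let g , endo , agree = extend-to-endo S r r-injective r-≼
      in g , endo
           , (λ c∈C c≢y → trans (agree (x∈p∪q⁺ (inj₁ (x∈p∧x≢y⇒x∈p-y c∈C c≢y))))
                                (r-fixes (λ c≡z → z∉C (subst (_∈ C) c≡z c∈C))))
           , trans (agree (x∈p∪q⁺ {p = C - y} (inj₂ (x∈⁅x⁆ z)))) r-z
      where
      S : Subset n
      S = (C - y) ∪ ⁅ z ⁆

      r : Fin n → Fin n
      r a with a ≟ z
      ... | yes _ = y
      ... | no _ = a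

      r-z : r z ≡ y
      r-z with z ≟ z
      ... | yes _ = refl
      ... | no z≢z = ⊥-elim (z≢z refl)

      r-fixes : ∀ {a} → a ≢ z → r a ≡ a
      r-fixes {a} a≢z with a ≟ z
      ... | yes a≡z = ⊥-elim (a≢z a≡z)
      ... | no _ = refl

      Redirected Fixed : Fin n → Set
      Redirected a = a ≡ z × r a ≡ y
      Fixed a = a ∈ C × a ≢ y × r a ≡ a

      r-on-S : ∀ {a} → a ∈ S → Redirected a ⊎ Fixed a
      r-on-S {a} a∈S with x∈p∪q⁻ (C - y) ⁅ z ⁆ a∈S
      ... | inj₂ a∈z = let a≡z = x∈⁅y⁆⇒x≡y z a∈z in inj₁ (a≡z , trans (cong r a≡z) r-z)
      ... | inj₁ a∈C-y =
        let a∈C = p─q⊆p C ⁅ y ⁆ a∈C-y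
        in inj₂ (a∈C , x∈p-y⇒x≢y a∈C-y , r-fixes (λ a≡z → z∉C (subst (_∈ C) a≡z a∈C)))

      r-injective : ∀ {a b} → a ∈ S → b ∈ S → r a ≡ r b → a ≡ b
      r-injective a∈ b∈ eq with r-on-S a∈ | r-on-S b∈
      ... | inj₁ (a≡z , _) | inj₁ (b≡z , _) = trans a≡z (sym b≡z)
      ... | inj₁ (_ , ra) | inj₂ (_ , b≢y , rb) = ⊥-elim (b≢y (trans (sym rb) (trans (sym eq) ra)))
      ... | inj₂ (_ , a≢y , ra) | inj₁ (_ , rb) = ⊥-elim (a≢y (trans (sym ra) (trans eq rb)))
      ... | inj₂ (_ , _ , ra) | inj₂ (_ , _ , rb) = trans (sym ra) (trans eq rb)

      r-≼ : ∀ {a b} → a ∈ S → b ∈ S → χ″ a b ≼ χ″ (r a) (r b)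
      r-≼ a∈ b∈ with r-on-S a∈ | r-on-S b∈
      ... | inj₁ (a≡z , _) | inj₁ (b≡z , _) rewrite a≡z | b≡z = χ″-diag-≼ z _
      ... | inj₁ (_ , ra) | inj₂ (b∈C , b≢y , rb) rewrite ra | rb = χ″-𝟙-≼ (cl y∈C b∈C (≢-sym b≢y)) _
      ... | inj₂ (a∈C , a≢y , ra) | inj₁ (_ , rb) rewrite ra | rb = χ″-𝟙-≼ (cl a∈C y∈C a≢y) _
      ... | inj₂ (_ , _ , ra) | inj₂ (_ , _ , rb) = reflexive (cong₂ χ″ (sym ra) (sym rb))

    has-𝟙-neighbour : (∃ λ x₀ → ∃ λ y₀ → χ″ x₀ y₀ ≡ 𝟙) → ∀ x → ∃ λ y → χ″ x y ≡ 𝟙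
    has-𝟙-neighbour (x₀ , y₀ , eq) x =
      let g , endo , gx₀≡x = endo-sending x₀ x
      in g y₀ , subst (λ a → χ″ a (g y₀) ≡ 𝟙) gx₀≡x (endo-preserves-𝟙 endo eq)

    module _ (𝟘≢𝟙 : 𝟘 ≢ 𝟙) where

      𝟙⇒≢ : ∀ {a b} → χ″ a b ≡ 𝟙 → a ≢ b
      𝟙⇒≢ {a} eq refl = 𝟘≢𝟙 (trans (sym (χ″-diag a)) eq)

      clique-absorbs : ∀ {y b} z → χ″ y b ≡ 𝟙 →
        (∀ {w} → χ″ w b ≡ 𝟙 → χ″ y z ≼ χ″ w y → χ″ w y ≡ 𝟙) →
        ∃ λ C → (Is𝟙Clique C × y ∈ C × b ∈ C) × z ∈ C
      clique-absorbs {y} {b} z yb𝟙 joins =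
        grow-until-∈ (λ C → Is𝟙Clique C × y ∈ C × b ∈ C) step
          (edge-clique yb𝟙 , p⊆p∪q ⁅ b ⁆ (x∈⁅x⁆ y) , x∈p∪q⁺ {p = ⁅ y ⁆} (inj₂ (x∈⁅x⁆ b)))
        where
        step : ∀ {C} → Is𝟙Clique C × y ∈ C × b ∈ C → z ∉ C →
          ∃ λ w → w ∉ C × (Is𝟙Clique (C ∪ ⁅ w ⁆) × y ∈ C ∪ ⁅ w ⁆ × b ∈ C ∪ ⁅ w ⁆)
        step {C} (cl , y∈C , b∈C) z∉C with redirect-endo cl y∈C z∉C
        ... | g , endo , fixes , gz≡y =
          g y , (λ gy∈C → 𝟙⇒≢ (joins-C gy∈C) refl)
              , clique-∪⁅⁆ cl joins-C , p⊆p∪q _ y∈C , p⊆p∪q _ b∈C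
          where
          joins-C∖y : ∀ {c} → c ∈ C → c ≢ y → χ″ (g y) c ≡ 𝟙
          joins-C∖y c∈C c≢y = subst (λ d → χ″ (g y) d ≡ 𝟙) (fixes c∈C c≢y)
                                 (endo-preserves-𝟙 endo (cl y∈C c∈C (≢-sym c≢y)))

          joins-y : χ″ (g y) y ≡ 𝟙
          joins-y = joins (joins-C∖y b∈C (≢-sym (𝟙⇒≢ yb𝟙)))
                      (subst (λ d → χ″ y z ≼ χ″ (g y) d) gz≡y (proj₂ endo y z))

          joins-C : ∀ {c} → c ∈ C → χ″ (g y) c ≡ 𝟙
          joins-C {c} c∈C with c ≟ y
          ... | yes refl = joins-y
          ... | no c≢y = joins-C∖y c∈C c≢y

      𝟙-transitive : ∀ {x y z} → x ≢ z → χ″ x y ≡ 𝟙 → χ″ y z ≡ 𝟙 → χ″ x z ≡ 𝟙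
      𝟙-transitive {x} {y} {z} x≢z xy𝟙 yz𝟙 =
        let _ , (cl , _ , x∈C) , z∈C = clique-absorbs z (trans (χ″-sym y x) xy𝟙)
                                          (λ _ ≼wy → 𝟙-maximal (subst (_≼ _) yz𝟙 ≼wy))
        in cl x∈C z∈C x≢z

      adjacent⇒𝟙 : (∃ λ x₀ → ∃ λ y₀ → χ″ x₀ y₀ ≡ 𝟙) → ∀ {u v} → Adj G u v → χ″ u v ≡ 𝟙
      adjacent⇒𝟙 edge {u} {v} uv≢𝟘 =
        let t , ut𝟙 = has-𝟙-neighbour edge u
            _ , (cl , u∈C , _) , v∈C = clique-absorbs v ut𝟙 (λ wt𝟙 ≼wu → 𝟙-transitive
                                          (λ { refl → uv≢𝟘 (𝟘-minimal (subst (_ ≼_) (χ″-diag u) ≼wu)) })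
                                          wt𝟙 (trans (χ″-sym t u) ut𝟙))
        in cl u∈C v∈C λ { refl → uv≢𝟘 (χ″-diag u) }

      Linked : Fin n → Fin n → Set c
      Linked a b = a ≡ b ⊎ χ″ a b ≡ 𝟙

      linked-trans : ∀ {a b d} → Linked a b → Linked b d → Linked a d
      linked-trans (inj₁ refl) bd = bd
      linked-trans ab (inj₁ refl) = ab
      linked-trans {a} {_} {d} (inj₂ ab𝟙) (inj₂ bd𝟙) with a ≟ d
      ... | yes a≡d = inj₁ a≡d
      ... | no a≢d = inj₂ (𝟙-transitive a≢d ab𝟙 bd𝟙)

      same-component⇒𝟙 : (∃ λ x₀ → ∃ λ y₀ → χ″ x₀ y₀ ≡ 𝟙) →
        ∀ {x y} → x ≢ y → SameComponent G x y → χ″ x y ≡ 𝟙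
      same-component⇒𝟙 edge x≢y xy
        with fold Linked (λ uv → linked-trans (inj₂ (adjacent⇒𝟙 edge uv))) (inj₁ refl) xy
      ... | inj₁ x≡y = ⊥-elim (x≢y x≡y)
      ... | inj₂ xy𝟙 = xy𝟙

mainTheorem7 : ∀ {c ℓ} (L : BoundedPoset c ℓ) → IsDiamond L →
    ∀ {n : ℕ} (G : ColoredGraph L n) →
    MH-homogeneous G → VertexUniform G →
    Σ (Fin n) (λ x₀ → Σ (Fin n) (λ y₀ → ColoredGraph.χ″ G x₀ y₀ ≡ BoundedPoset.𝟙 L)) →
    (∀ x → Σ (Fin n) (λ y → ColoredGraph.χ″ G x y ≡ BoundedPoset.𝟙 L))
    × (∀ x y z → x ≢ y → y ≢ z → x ≢ z →
    ColoredGraph.χ″ G x y ≡ BoundedPoset.𝟙 L → ColoredGraph.χ″ G y z ≡ BoundedPoset.𝟙 L →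
    ColoredGraph.χ″ G x z ≡ BoundedPoset.𝟙 L)
    × (∀ x y → x ≢ y → SameComponent G x y → ColoredGraph.χ″ G x y ≡ BoundedPoset.𝟙 L)
mainTheorem7 L (𝟘≢𝟙 , _) G mh vu edge =
    has-𝟙-neighbour edge
  , (λ _ _ _ _ _ x≢z → 𝟙-transitive 𝟘≢𝟙 x≢z)
  , (λ _ _ → same-component⇒𝟙 𝟘≢𝟙 edge)
  where open Colouring.Homogeneous G mh vu
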